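{- Let $W$ be the 3-way filter automaton over the move alphabet $\Gamma=\mathfrak M\cup\mathfrak X$ (described in the context), started in its initial state $0$. Let $u_1\in\{1,x\}^*$, $u_2\in\{1,x_L,x_R\}^*$ and $u_3\in\{1,x\}^*$ be the type sequences of transitions along given paths in $T_1$, $T_2$, $T_3$ respectively, which determine two grid points $(p,q,r)\preceq(s,t,u)$. Suppose at least one move sequence $\pi\in\Gamma^*$ has projections $(u_1,u_2,u_3)$. Then exactly one move sequence with projections $(u_1,u_2,u_3)$ is accepted by $W$.
   Context: Setting: 3-way composition of weighted transducers $T_1,T_2,T_3$, where $\epsilon$-paths must be matched simultaneously in all three. Each composition step is a triplet whose $i$-th entry is the move made in $T_i$: - $0$: stay at the current state of $T_i$. - $1$: move along an $\epsilon$-transition. For $T_1$ this means output $\epsilon$; for $T_2$, input and output $\epsilon$; for $T_3$, input $\epsilon$. - $x$: move along a matching transition with a non-empty symbol. For $T_1$, non-$\epsilon$ output; for $T_3$, non-$\epsilon$ input. For $T_2$ there are two types: $x_L$ (non-$\epsilon$ input matched with $T_1$) and $x_R$ (non-$\epsilon$ output matched with $T_3$). Let $\mathfrak M=\{(m_1,m_2,m_3):m_i\in\{0,1\}\}$ and $\mathfrak X=\{(x,x_L,m),(m,x_R,x):m\in\{0,1\}\}$. The move alphabet is $\Gamma=\mathfrak M\cup\mathfrak X$. The $i$-th projection of $\pi\in\Gamma^*$ is the word obtained by reading the $i$-th components of its letters and deleting the $0$s. It records the sequence of transitions consumed in $T_i$. Two move sequences are equivalent when all three projections coincide, i.e. they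 consume the same sequence of transitions in each transducer. Positions along the three paths form a 3-dimensional grid, and $(p,q,r)\preceq(s,t,u)$ means $(s,t,u)$ is reachable from $(p,q,r)$. In the conditions below, "$x$ in position $2$" means $x_L$ or $x_R$. $W$ is the minimal deterministic automaton with initial state $0$ and all states final; $W$ additionally has an $(x,x,x)$-transition from every state back to $0$, which resets the filter. On words of $\Gamma^*$, $W$ accepts exactly the sequences containing none of the following forbidden patterns: - (i) a letter $(0,0,0)$; - (ii) two consecutive letters $t,t'$ such that for some $i\in\{1,2,3\}$, $t_i=0$ and $t'_i=1$; - (iii) two consecutive letters $t,t'$ with $t_1=t_2=0$ and $t'_1,t'_2$ both $x$, or with $t_2=t_3=0$ and $t'_2,t'_3$ both $x$. -}

module Defs where

open import Data.List using (List; []; _∷_)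
open import Data.List.Relation.Unary.All using (All)
open import Data.List.Relation.Unary.Linked using (Linked)
open import Data.Product using (_×_)
open import Data.Sum using (_⊎_)
open import Relation.Binary.PropositionalEquality using (_≡_)
open import Relation.Nullary using (¬_)

-- A non-x move component: 0 (stay) or 1 (epsilon transition).
data Bit : Set where
  b0 b1 : Bit

data Γ : Set where
  mv  : Bit → Bit → Bit → Γ
  xL  : Bit → Γ
  xR  : Bit → Γ

data C13 : Set where
  z o x : C13

data C2 : Set where
  z₂ o₂ xl xr : C2

bitC13 : Bit → C13
bitC13 b0 = z
bitC13 b1 = o

bitC2 : Bit → C2
bitC2 b0 = z₂
bitC2 b1 = o₂

comp₁ : Γ → C13
comp₁ (mv a _ _) = bitC13 a
comp₁ (xL _)     = x
comp₁ (xR m)     = bitC13 m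

comp₂ : Γ → C2
comp₂ (mv _ b _) = bitC2 b
comp₂ (xL _)     = xl
comp₂ (xR _)     = xr

comp₃ : Γ → C13
comp₃ (mv _ _ c) = bitC13 c
comp₃ (xL m)     = bitC13 m
comp₃ (xR _)     = x

data S13 : Set where
  s1 sx : S13

data S2 : Set where
  t1 txL txR : S2

proj₁ : List Γ → List S13
proj₁ [] = []
proj₁ (t ∷ π) with comp₁ t
... | z = proj₁ π
... | o = s1 ∷ proj₁ π
... | x = sx ∷ proj₁ π

proj₂ : List Γ → List S2
proj₂ [] = []
proj₂ (t ∷ π) with comp₂ t
... | z₂ = proj₂ π
... | o₂ = t1 ∷ proj₂ π
... | xl = txL ∷ proj₂ π
... | xr = txR ∷ proj₂ π

proj₃ : List Γ → List S13
proj₃ [] = []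
proj₃ (t ∷ π) with comp₃ t
... | z = proj₃ π
... | o = s1 ∷ proj₃ π
... | x = sx ∷ proj₃ π

HasProjections : List Γ → List S13 → List S2 → List S13 → Set
HasProjections π u₁ u₂ u₃ = proj₁ π ≡ u₁ × proj₂ π ≡ u₂ × proj₃ π ≡ u₃

IsX₂ : C2 → Set
IsX₂ c = c ≡ xl ⊎ c ≡ xr

ZeroLetter : Γ → Set
ZeroLetter t = comp₁ t ≡ z × comp₂ t ≡ z₂ × comp₃ t ≡ z

BadPair : Γ → Γ → Set
BadPair t t' =
    (comp₁ t ≡ z × comp₁ t' ≡ o)
  ⊎ (comp₂ t ≡ z₂ × comp₂ t' ≡ o₂)
  ⊎ (comp₃ t ≡ z × comp₃ t' ≡ o)
  ⊎ (comp₁ t ≡ z × comp₂ t ≡ z₂ × comp₁ t' ≡ x × IsX₂ (comp₂ t'))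
  ⊎ (comp₂ t ≡ z₂ × comp₃ t ≡ z × IsX₂ (comp₂ t') × comp₃ t' ≡ x)

-- Words of Γ* accepted by the filter W started in state 0:
-- exactly those containing none of the forbidden patterns.
AcceptedByW : List Γ → Set
AcceptedByW π = All (λ t → ¬ ZeroLetter t) π × Linked (λ t t' → ¬ BadPair t t') π

-- In an accepted word every letter is forced by the next transition types of the
-- three paths still to be consumed, so two accepted words with the same projections
-- agree letter by letter. Conversely, reading off the forced letters consumes the
-- paths greedily: when u₁ has as many x as u₂ has x_L, and u₃ as many x as u₂ has
-- x_R (which holds for projections), a forced letter is never (0,0,0) before all
-- three paths are consumed, and two consecutive forced letters never form a
-- forbidden pattern.
module Submission where

open import Defs
open import Data.Empty using (⊥-elim)
open import Data.List using (List; []; _∷_; _++_; head; length)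
open import Data.List.Properties using (++-cancelˡ; ++-conicalˡ; length-++-≤ʳ)
open import Data.List.Relation.Unary.All using ([]; _∷_)
open import Data.List.Relation.Unary.Linked as Linked using (Linked; []; [-]; _∷_)
open import Data.Maybe using (Maybe; just; nothing)
open import Data.Nat using (ℕ; suc; _+_; _<_; s≤s)
open import Data.Nat.Induction using (<-wellFounded)
open import Data.Nat.Properties using (+-cancelˡ-≡; +-mono-≤; +-mono-<-≤; +-mono-≤-<)
open import Data.Product using (∃; ∃!; _×_; _,_)
open import Data.Sum using (inj₁; inj₂)
open import Function using (_∋_; _∘_)
open import Induction.WellFounded using (Acc; acc)
open import Relation.Binary.PropositionalEquality using (_≡_; _≢_; refl; sym; trans; cong; cong₂; subst)
open import Relation.Nullary using (¬_; Dec; yes; no)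

consumed : C13 → List S13
consumed z = []
consumed o = s1 ∷ []
consumed x = sx ∷ []

consumed₂ : C2 → List S2
consumed₂ z₂ = []
consumed₂ o₂ = t1 ∷ []
consumed₂ xl = txL ∷ []
consumed₂ xr = txR ∷ []

Paths : Set
Paths = List S13 × List S2 × List S13

∅ : Paths
∅ = [] , [] , []

paths-injective : ∀ {u₁ u₂ u₃ v₁ v₂ v₃} → (Paths ∋ (u₁ , u₂ , u₃)) ≡ (v₁ , v₂ , v₃) → u₁ ≡ v₁ × u₂ ≡ v₂ × u₃ ≡ v₃
paths-injective refl = refl , refl , refl

_++ₚ_ : Paths → Paths → Paths
(a₁ , a₂ , a₃) ++ₚ (v₁ , v₂ , v₃) = a₁ ++ v₁ , a₂ ++ v₂ , a₃ ++ v₃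

transitions : Γ → Paths
transitions t = consumed (comp₁ t) , consumed₂ (comp₂ t) , consumed (comp₃ t)

projections : List Γ → Paths
projections π = proj₁ π , proj₂ π , proj₃ π

proj₁-∷ : ∀ t π → proj₁ (t ∷ π) ≡ consumed (comp₁ t) ++ proj₁ π
proj₁-∷ t π with comp₁ t
... | z = refl
... | o = refl
... | x = refl

proj₂-∷ : ∀ t π → proj₂ (t ∷ π) ≡ consumed₂ (comp₂ t) ++ proj₂ π
proj₂-∷ t π with comp₂ t
... | z₂ = refl
... | o₂ = refl
... | xl = refl
... | xr = refl

proj₃-∷ : ∀ t π → proj₃ (t ∷ π) ≡ consumed (comp₃ t) ++ proj₃ π
proj₃-∷ t π with comp₃ t
... | z = refl
... | o = refl
... | x = refl

projections-∷ : ∀ t π → projections (t ∷ π) ≡ transitions t ++ₚ projections π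
projections-∷ t π rewrite proj₁-∷ t π | proj₂-∷ t π | proj₃-∷ t π = refl

++ₚ-cancelˡ : ∀ a {v w} → a ++ₚ v ≡ a ++ₚ w → v ≡ w
++ₚ-cancelˡ (a₁ , a₂ , a₃) e with e₁ , e₂ , e₃ ← paths-injective e =
  cong₂ _,_ (++-cancelˡ a₁ _ _ e₁) (cong₂ _,_ (++-cancelˡ a₂ _ _ e₂) (++-cancelˡ a₃ _ _ e₃))

++ₚ-conicalˡ : ∀ a v → a ++ₚ v ≡ ∅ → a ≡ ∅
++ₚ-conicalˡ (a₁ , a₂ , a₃) (v₁ , v₂ , v₃) e with e₁ , e₂ , e₃ ← paths-injective e =
  cong₂ _,_ (++-conicalˡ a₁ v₁ e₁) (cong₂ _,_ (++-conicalˡ a₂ v₂ e₂) (++-conicalˡ a₃ v₃ e₃))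

consumed-≡[] : ∀ c → consumed c ≡ [] → c ≡ z
consumed-≡[] z _ = refl

consumed₂-≡[] : ∀ c → consumed₂ c ≡ [] → c ≡ z₂
consumed₂-≡[] z₂ _ = refl

transitions-≡∅ : ∀ t → transitions t ≡ ∅ → ZeroLetter t
transitions-≡∅ t e with e₁ , e₂ , e₃ ← paths-injective e =
  consumed-≡[] (comp₁ t) e₁ , consumed₂-≡[] (comp₂ t) e₂ , consumed-≡[] (comp₃ t) e₃

empty-projections : ∀ t ρ → projections (t ∷ ρ) ≡ ∅ → ZeroLetter t
empty-projections t ρ e =
  transitions-≡∅ t (++ₚ-conicalˡ (transitions t) (projections ρ) (trans (sym (projections-∷ t ρ)) e))

-- Components of the move the filter forces when the next transitions have types h₁ h₂ h₃ (nothing: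
-- the path is consumed): an ε-transition is taken at once, as pattern (ii) forbids
-- taking it after a stay, and x_L (x_R) as soon as T₁ and T₂ (T₂ and T₃) both offer
-- it, as pattern (iii) forbids taking it after both stayed.
next₁ : Maybe S13 → Maybe S2 → C13
next₁ (just s1) _          = o
next₁ (just sx) (just txL) = x
next₁ _         _          = z

next₂ : Maybe S13 → Maybe S2 → Maybe S13 → C2
next₂ _         (just t1)  _         = o₂
next₂ (just sx) (just txL) _         = xl
next₂ _         (just txR) (just sx) = xr
next₂ _         _          _         = z₂

next₃ : Maybe S2 → Maybe S13 → C13
next₃ _          (just s1) = o
next₃ (just txR) (just sx) = x
next₃ _          _         = z

εBit : Maybe S13 → Bit
εBit (just s1) = b1
εBit _         = b0

εBit₂ : Maybe S2 → Bit
εBit₂ (just t1) = b1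
εBit₂ _         = b0

nextMove : Maybe S13 → Maybe S2 → Maybe S13 → Γ
nextMove h₁        (just txR) (just sx) = xR (εBit h₁)
nextMove (just sx) (just txL) h₃        = xL (εBit h₃)
nextMove h₁        h₂         h₃        = mv (εBit h₁) (εBit₂ h₂) (εBit h₃)

nextMoveOf : Paths → Γ
nextMoveOf (u₁ , u₂ , u₃) = nextMove (head u₁) (head u₂) (head u₃)

IsNextMove : Γ → Maybe S13 → Maybe S2 → Maybe S13 → Set
IsNextMove t h₁ h₂ h₃ = comp₁ t ≡ next₁ h₁ h₂ × comp₂ t ≡ next₂ h₁ h₂ h₃ × comp₃ t ≡ next₃ h₂ h₃

nextMove-isNextMove : ∀ h₁ h₂ h₃ → IsNextMove (nextMove h₁ h₂ h₃) h₁ h₂ h₃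
nextMove-isNextMove nothing   nothing    nothing   = refl , refl , refl
nextMove-isNextMove nothing   nothing    (just s1) = refl , refl , refl
nextMove-isNextMove nothing   nothing    (just sx) = refl , refl , refl
nextMove-isNextMove nothing   (just t1)  nothing   = refl , refl , refl
nextMove-isNextMove nothing   (just t1)  (just s1) = refl , refl , refl
nextMove-isNextMove nothing   (just t1)  (just sx) = refl , refl , refl
nextMove-isNextMove nothing   (just txL) nothing   = refl , refl , refl
nextMove-isNextMove nothing   (just txL) (just s1) = refl , refl , refl
nextMove-isNextMove nothing   (just txL) (just sx) = refl , refl , refl
nextMove-isNextMove nothing   (just txR) nothing   = refl , refl , refl
nextMove-isNextMove nothing   (just txR) (just s1) = refl , refl , refl
nextMove-isNextMove nothing   (just txR) (just sx) = refl , refl , refl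
nextMove-isNextMove (just s1) nothing    nothing   = refl , refl , refl
nextMove-isNextMove (just s1) nothing    (just s1) = refl , refl , refl
nextMove-isNextMove (just s1) nothing    (just sx) = refl , refl , refl
nextMove-isNextMove (just s1) (just t1)  nothing   = refl , refl , refl
nextMove-isNextMove (just s1) (just t1)  (just s1) = refl , refl , refl
nextMove-isNextMove (just s1) (just t1)  (just sx) = refl , refl , refl
nextMove-isNextMove (just s1) (just txL) nothing   = refl , refl , refl
nextMove-isNextMove (just s1) (just txL) (just s1) = refl , refl , refl
nextMove-isNextMove (just s1) (just txL) (just sx) = refl , refl , refl
nextMove-isNextMove (just s1) (just txR) nothing   = refl , refl , refl
nextMove-isNextMove (just s1) (just txR) (just s1) = refl , refl , refl
nextMove-isNextMove (just s1) (just txR) (just sx) = refl , refl , refl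
nextMove-isNextMove (just sx) nothing    nothing   = refl , refl , refl
nextMove-isNextMove (just sx) nothing    (just s1) = refl , refl , refl
nextMove-isNextMove (just sx) nothing    (just sx) = refl , refl , refl
nextMove-isNextMove (just sx) (just t1)  nothing   = refl , refl , refl
nextMove-isNextMove (just sx) (just t1)  (just s1) = refl , refl , refl
nextMove-isNextMove (just sx) (just t1)  (just sx) = refl , refl , refl
nextMove-isNextMove (just sx) (just txL) nothing   = refl , refl , refl
nextMove-isNextMove (just sx) (just txL) (just s1) = refl , refl , refl
nextMove-isNextMove (just sx) (just txL) (just sx) = refl , refl , refl
nextMove-isNextMove (just sx) (just txR) nothing   = refl , refl , refl
nextMove-isNextMove (just sx) (just txR) (just s1) = refl , refl , refl
nextMove-isNextMove (just sx) (just txR) (just sx) = refl , refl , refl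

nextMove-𝔐 : ∀ h₁ h₂ h₃ → ¬ (h₁ ≡ just sx × h₂ ≡ just txL) → ¬ (h₂ ≡ just txR × h₃ ≡ just sx) →
             nextMove h₁ h₂ h₃ ≡ mv (εBit h₁) (εBit₂ h₂) (εBit h₃)
nextMove-𝔐 _         nothing    _         _    _    = refl
nextMove-𝔐 _         (just t1)  _         _    _    = refl
nextMove-𝔐 nothing   (just txL) _         _    _    = refl
nextMove-𝔐 (just s1) (just txL) _         _    _    = refl
nextMove-𝔐 (just sx) (just txL) _         ¬xL  _    with () ← ¬xL (refl , refl)
nextMove-𝔐 _         (just txR) nothing   _    _    = refl
nextMove-𝔐 _         (just txR) (just s1) _    _    = refl
nextMove-𝔐 _         (just txR) (just sx) _    ¬xR  with () ← ¬xR (refl , refl)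

εBit-≢ : ∀ {h} → h ≢ just s1 → εBit h ≡ b0
εBit-≢ {nothing}   _   = refl
εBit-≢ {just s1} ¬ε = ⊥-elim (¬ε refl)
εBit-≢ {just sx}   _   = refl

εBit₂-≢ : ∀ {h} → h ≢ just t1 → εBit₂ h ≡ b0
εBit₂-≢ {nothing}  _   = refl
εBit₂-≢ {just t1}  ¬ε = ⊥-elim (¬ε refl)
εBit₂-≢ {just txL} _   = refl
εBit₂-≢ {just txR} _   = refl

mv-cong : ∀ {a a' b b' c c'} → a ≡ a' → b ≡ b' → c ≡ c' → mv a b c ≡ mv a' b' c'
mv-cong refl refl refl = refl

Filtered : List Γ → Set
Filtered = Linked (λ t t' → ¬ BadPair t t')

no-ε₁-after-stay : ∀ {t ρ} → comp₁ t ≡ z → Filtered (t ∷ ρ) → head (proj₁ ρ) ≢ just s1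
no-ε₁-after-stay {ρ = []}    _    _           ()
no-ε₁-after-stay {ρ = r ∷ ρ} stay (ok ∷ rest) with comp₁ r in eq
... | z = no-ε₁-after-stay eq rest
... | o = λ _ → ok (inj₁ (stay , refl))
... | x = λ ()

no-ε₂-after-stay : ∀ {t ρ} → comp₂ t ≡ z₂ → Filtered (t ∷ ρ) → head (proj₂ ρ) ≢ just t1
no-ε₂-after-stay {ρ = []}    _    _           ()
no-ε₂-after-stay {ρ = r ∷ ρ} stay (ok ∷ rest) with comp₂ r in eq
... | z₂ = no-ε₂-after-stay eq rest
... | o₂ = λ _ → ok (inj₂ (inj₁ (stay , refl)))
... | xl = λ ()
... | xr = λ ()

no-ε₃-after-stay : ∀ {t ρ} → comp₃ t ≡ z → Filtered (t ∷ ρ) → head (proj₃ ρ) ≢ just s1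
no-ε₃-after-stay {ρ = []}    _    _           ()
no-ε₃-after-stay {ρ = r ∷ ρ} stay (ok ∷ rest) with comp₃ r in eq
... | z = no-ε₃-after-stay eq rest
... | o = λ _ → ok (inj₂ (inj₂ (inj₁ (stay , refl))))
... | x = λ ()

no-xL-ahead : ∀ {a b c} ρ → Filtered (mv a b c ∷ ρ) →
              ¬ (head (proj₁ (mv a b c ∷ ρ)) ≡ just sx × head (proj₂ (mv a b c ∷ ρ)) ≡ just txL)
no-xL-ahead {b1}          _                 _          (() , _)
no-xL-ahead {b0} {b1}     _                 _          (_ , ())
no-xL-ahead {b0} {b0} []                    _          (() , _)
no-xL-ahead {b0} {b0} (mv b1 _ _ ∷ _)       _          (() , _)
no-xL-ahead {b0} {b0} (mv b0 b1 _ ∷ _)      _          (_ , ())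
no-xL-ahead {b0} {b0} (mv b0 b0 _ ∷ ρ)      (_ ∷ rest) = no-xL-ahead ρ rest
no-xL-ahead {b0} {b0} (xL _ ∷ _)            (ok ∷ _)   _ = ok (inj₂ (inj₂ (inj₂ (inj₁ (refl , refl , refl , inj₁ refl)))))
no-xL-ahead {b0} {b0} (xR _ ∷ _)            _          (_ , ())

no-xR-ahead : ∀ {a b c} ρ → Filtered (mv a b c ∷ ρ) →
              ¬ (head (proj₂ (mv a b c ∷ ρ)) ≡ just txR × head (proj₃ (mv a b c ∷ ρ)) ≡ just sx)
no-xR-ahead {_} {b1}      _                 _          (() , _)
no-xR-ahead {_} {b0} {b1} _                 _          (_ , ())
no-xR-ahead {_} {b0} {b0} []                _          (() , _)
no-xR-ahead {_} {b0} {b0} (mv _ _ b1 ∷ _)   _          (_ , ())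
no-xR-ahead {_} {b0} {b0} (mv _ b1 b0 ∷ _)  _          (() , _)
no-xR-ahead {_} {b0} {b0} (mv _ b0 b0 ∷ ρ)  (_ ∷ rest) = no-xR-ahead ρ rest
no-xR-ahead {_} {b0} {b0} (xR _ ∷ _)        (ok ∷ _)   _ = ok (inj₂ (inj₂ (inj₂ (inj₂ (refl , refl , inj₂ refl , refl)))))
no-xR-ahead {_} {b0} {b0} (xL _ ∷ _)        _          (() , _)

ε₁-determined : ∀ {t ρ} a → comp₁ t ≡ bitC13 a → Filtered (t ∷ ρ) → a ≡ εBit (head (proj₁ (t ∷ ρ)))
ε₁-determined {t} {ρ} b1 eq _  rewrite proj₁-∷ t ρ | eq = refl
ε₁-determined {t} {ρ} b0 eq lk rewrite proj₁-∷ t ρ | eq = sym (εBit-≢ (no-ε₁-after-stay eq lk))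

ε₂-determined : ∀ {t ρ} b → comp₂ t ≡ bitC2 b → Filtered (t ∷ ρ) → b ≡ εBit₂ (head (proj₂ (t ∷ ρ)))
ε₂-determined {t} {ρ} b1 eq _  rewrite proj₂-∷ t ρ | eq = refl
ε₂-determined {t} {ρ} b0 eq lk rewrite proj₂-∷ t ρ | eq = sym (εBit₂-≢ (no-ε₂-after-stay eq lk))

ε₃-determined : ∀ {t ρ} c → comp₃ t ≡ bitC13 c → Filtered (t ∷ ρ) → c ≡ εBit (head (proj₃ (t ∷ ρ)))
ε₃-determined {t} {ρ} b1 eq _  rewrite proj₃-∷ t ρ | eq = refl
ε₃-determined {t} {ρ} b0 eq lk rewrite proj₃-∷ t ρ | eq = sym (εBit-≢ (no-ε₃-after-stay eq lk))

nextMove-determined : ∀ t ρ → Filtered (t ∷ ρ) → t ≡ nextMoveOf (projections (t ∷ ρ))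
nextMove-determined (mv a b c) ρ lk =
  trans (mv-cong (ε₁-determined a refl lk) (ε₂-determined b refl lk) (ε₃-determined c refl lk))
        (sym (nextMove-𝔐 _ _ _ (no-xL-ahead ρ lk) (no-xR-ahead ρ lk)))
nextMove-determined (xL m) ρ lk = cong xL (ε₃-determined m refl lk)
nextMove-determined (xR m) ρ lk = cong xR (ε₁-determined m refl lk)

accepted-unique : ∀ π π' → projections π ≡ projections π' → AcceptedByW π → AcceptedByW π' → π ≡ π'
accepted-unique []      []        _ _                _                = refl
accepted-unique []      (t' ∷ ρ') e _                (moves' ∷ _ , _) =
  ⊥-elim (moves' (empty-projections t' ρ' (sym e)))
accepted-unique (t ∷ ρ) []        e (moves ∷ _ , _)  _                =
  ⊥-elim (moves (empty-projections t ρ e))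
accepted-unique (t ∷ ρ) (t' ∷ ρ') e (_ ∷ ms , lk) (_ ∷ ms' , lk')
  with refl ← trans (nextMove-determined t ρ lk) (trans (cong nextMoveOf e) (sym (nextMove-determined t' ρ' lk')))
  = cong (t ∷_) (accepted-unique ρ ρ' tails-agree (ms , Linked.tail lk) (ms' , Linked.tail lk'))
  where
  tails-agree : projections ρ ≡ projections ρ'
  tails-agree = ++ₚ-cancelˡ (transitions t) (trans (sym (projections-∷ t ρ)) (trans e (projections-∷ t ρ')))

#x : List S13 → ℕ
#x []       = 0
#x (s1 ∷ u) = #x u
#x (sx ∷ u) = suc (#x u)

#xL : List S2 → ℕ
#xL []        = 0
#xL (txL ∷ u) = suc (#xL u)
#xL (_   ∷ u) = #xL u

#xR : List S2 → ℕ
#xR []        = 0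
#xR (txR ∷ u) = suc (#xR u)
#xR (_   ∷ u) = #xR u

#x-++ : ∀ u v → #x (u ++ v) ≡ #x u + #x v
#x-++ []       _ = refl
#x-++ (s1 ∷ u) v = #x-++ u v
#x-++ (sx ∷ u) v = cong suc (#x-++ u v)

#xL-++ : ∀ u v → #xL (u ++ v) ≡ #xL u + #xL v
#xL-++ []        _ = refl
#xL-++ (t1 ∷ u)  v = #xL-++ u v
#xL-++ (txL ∷ u) v = cong suc (#xL-++ u v)
#xL-++ (txR ∷ u) v = #xL-++ u v

#xR-++ : ∀ u v → #xR (u ++ v) ≡ #xR u + #xR v
#xR-++ []        _ = refl
#xR-++ (t1 ∷ u)  v = #xR-++ u v
#xR-++ (txL ∷ u) v = #xR-++ u v
#xR-++ (txR ∷ u) v = cong suc (#xR-++ u v)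

Balanced : Paths → Set
Balanced (u₁ , u₂ , u₃) = #x u₁ ≡ #xL u₂ × #x u₃ ≡ #xR u₂

transitions-balanced : ∀ t → Balanced (transitions t)
transitions-balanced (mv b0 b0 b0) = refl , refl
transitions-balanced (mv b0 b0 b1) = refl , refl
transitions-balanced (mv b0 b1 b0) = refl , refl
transitions-balanced (mv b0 b1 b1) = refl , refl
transitions-balanced (mv b1 b0 b0) = refl , refl
transitions-balanced (mv b1 b0 b1) = refl , refl
transitions-balanced (mv b1 b1 b0) = refl , refl
transitions-balanced (mv b1 b1 b1) = refl , refl
transitions-balanced (xL b0)       = refl , refl
transitions-balanced (xL b1)       = refl , refl
transitions-balanced (xR b0)       = refl , refl
transitions-balanced (xR b1)       = refl , refl

balanced-++ : ∀ a v → Balanced a → Balanced v → Balanced (a ++ₚ v)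
balanced-++ (a₁ , a₂ , a₃) (v₁ , v₂ , v₃) (p , q) (p' , q') =
  trans (#x-++ a₁ v₁) (trans (cong₂ _+_ p p') (sym (#xL-++ a₂ v₂))) ,
  trans (#x-++ a₃ v₃) (trans (cong₂ _+_ q q') (sym (#xR-++ a₂ v₂)))

balanced-cancelˡ : ∀ a v → Balanced a → Balanced (a ++ₚ v) → Balanced v
balanced-cancelˡ (a₁ , a₂ , a₃) (v₁ , v₂ , v₃) (p , q) (p' , q') =
  +-cancelˡ-≡ (#xL a₂) _ _ (trans (cong (_+ #x v₁) (sym p)) (trans (sym (#x-++ a₁ v₁)) (trans p' (#xL-++ a₂ v₂)))) ,
  +-cancelˡ-≡ (#xR a₂) _ _ (trans (cong (_+ #x v₃) (sym q)) (trans (sym (#x-++ a₃ v₃)) (trans q' (#xR-++ a₂ v₂))))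

projections-balanced : ∀ π → Balanced (projections π)
projections-balanced []      = refl , refl
projections-balanced (t ∷ π) = subst Balanced (sym (projections-∷ t π))
  (balanced-++ (transitions t) (projections π) (transitions-balanced t) (projections-balanced π))

next₁≡o : ∀ {h₁ h₂} → next₁ h₁ h₂ ≡ o → h₁ ≡ just s1
next₁≡o {just s1}              _  = refl
next₁≡o {nothing}              ()
next₁≡o {just sx} {nothing}    ()
next₁≡o {just sx} {just t1}    ()
next₁≡o {just sx} {just txL}   ()
next₁≡o {just sx} {just txR}   ()

next₁≡x : ∀ {h₁ h₂} → next₁ h₁ h₂ ≡ x → h₁ ≡ just sx × h₂ ≡ just txL
next₁≡x {just sx} {just txL}   _  = refl , refl
next₁≡x {nothing}              ()
next₁≡x {just s1}              ()
next₁≡x {just sx} {nothing}    ()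
next₁≡x {just sx} {just t1}    ()
next₁≡x {just sx} {just txR}   ()

next₂≡o₂ : ∀ {h₁ h₂ h₃} → next₂ h₁ h₂ h₃ ≡ o₂ → h₂ ≡ just t1
next₂≡o₂ {_}       {just t1}              _  = refl
next₂≡o₂ {_}       {nothing}              ()
next₂≡o₂ {nothing} {just txL}             ()
next₂≡o₂ {just s1} {just txL}             ()
next₂≡o₂ {just sx} {just txL}             ()
next₂≡o₂ {_}       {just txR} {nothing}   ()
next₂≡o₂ {_}       {just txR} {just s1}   ()
next₂≡o₂ {_}       {just txR} {just sx}   ()

next₃≡o : ∀ {h₂ h₃} → next₃ h₂ h₃ ≡ o → h₃ ≡ just s1
next₃≡o {_}         {just s1}  _  = refl
next₃≡o {_}         {nothing}  ()
next₃≡o {nothing}   {just sx}  ()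
next₃≡o {just t1}   {just sx}  ()
next₃≡o {just txL}  {just sx}  ()
next₃≡o {just txR}  {just sx}  ()

next₃≡x : ∀ {h₂ h₃} → next₃ h₂ h₃ ≡ x → h₂ ≡ just txR × h₃ ≡ just sx
next₃≡x {just txR} {just sx}   _  = refl , refl
next₃≡x {_}        {nothing}   ()
next₃≡x {_}        {just s1}   ()
next₃≡x {nothing}  {just sx}   ()
next₃≡x {just t1}  {just sx}   ()
next₃≡x {just txL} {just sx}   ()

isNextMove-compatible : ∀ {t t' h₁ h₂ h₃ k₁ k₂ k₃} → IsNextMove t h₁ h₂ h₃ → IsNextMove t' k₁ k₂ k₃ →
  (comp₁ t ≡ z → h₁ ≡ k₁) → (comp₂ t ≡ z₂ → h₂ ≡ k₂) → (comp₃ t ≡ z → h₃ ≡ k₃) → ¬ BadPair t t'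
isNextMove-compatible (n₁ , _ , _) (n₁' , _ , _) same₁ _ _ (inj₁ (stay , ε))
  with refl ← same₁ stay | refl ← next₁≡o (trans (sym n₁') ε) | () ← trans (sym stay) n₁
isNextMove-compatible (_ , n₂ , _) (_ , n₂' , _) _ same₂ _ (inj₂ (inj₁ (stay , ε)))
  with refl ← same₂ stay | refl ← next₂≡o₂ (trans (sym n₂') ε) | () ← trans (sym stay) n₂
isNextMove-compatible (_ , _ , n₃) (_ , _ , n₃') _ _ same₃ (inj₂ (inj₂ (inj₁ (stay , ε))))
  with refl ← same₃ stay | refl ← next₃≡o (trans (sym n₃') ε) | () ← trans (sym stay) n₃
isNextMove-compatible (n₁ , _ , _) (n₁' , _ , _) same₁ same₂ _ (inj₂ (inj₂ (inj₂ (inj₁ (stay₁ , stay₂ , χ , _)))))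
  with refl ← same₁ stay₁ | refl ← same₂ stay₂ | refl , refl ← next₁≡x (trans (sym n₁') χ) | () ← trans (sym stay₁) n₁
isNextMove-compatible (_ , _ , n₃) (_ , _ , n₃') _ same₂ same₃ (inj₂ (inj₂ (inj₂ (inj₂ (stay₂ , stay₃ , _ , χ)))))
  with refl ← same₂ stay₂ | refl ← same₃ stay₃ | refl , refl ← next₃≡x (trans (sym n₃') χ) | () ← trans (sym stay₃) n₃

stay-head : ∀ {c u v} → c ≡ z → u ≡ consumed c ++ v → head u ≡ head v
stay-head refl refl = refl

stay-head₂ : ∀ {c u v} → c ≡ z₂ → u ≡ consumed₂ c ++ v → head u ≡ head v
stay-head₂ refl refl = refl

nextMoveOf-compatible : ∀ u v → u ≡ transitions (nextMoveOf u) ++ₚ v → ¬ BadPair (nextMoveOf u) (nextMoveOf v)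
nextMoveOf-compatible (u₁ , u₂ , u₃) (v₁ , v₂ , v₃) e with e₁ , e₂ , e₃ ← paths-injective e =
  isNextMove-compatible {nextMoveOf (u₁ , u₂ , u₃)} {nextMoveOf (v₁ , v₂ , v₃)}
    (nextMove-isNextMove (head u₁) (head u₂) (head u₃)) (nextMove-isNextMove (head v₁) (head v₂) (head v₃))
    (λ stay → stay-head stay e₁) (λ stay → stay-head₂ stay e₂) (λ stay → stay-head stay e₃)

idle-empty₁ : ∀ {u h} → #x u ≡ 0 → next₁ (head u) h ≡ z → u ≡ []
idle-empty₁ {[]}     _  _  = refl
idle-empty₁ {s1 ∷ _} _  ()
idle-empty₁ {sx ∷ _} () _

idle-empty₃ : ∀ {u h} → #x u ≡ 0 → next₃ h (head u) ≡ z → u ≡ []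
idle-empty₃ {[]}     _  _  = refl
idle-empty₃ {s1 ∷ _} _  ()
idle-empty₃ {sx ∷ _} () _

idle⇒empty : ∀ u₁ u₂ u₃ → Balanced (u₁ , u₂ , u₃) → next₁ (head u₁) (head u₂) ≡ z →
  next₂ (head u₁) (head u₂) (head u₃) ≡ z₂ → next₃ (head u₂) (head u₃) ≡ z → (u₁ , u₂ , u₃) ≡ ∅
idle⇒empty _        []        _        (p , q) s₁ _  s₃ = cong₂ (λ a b → a , [] , b) (idle-empty₁ p s₁) (idle-empty₃ q s₃)
idle⇒empty _        (t1 ∷ _)  _        _       _  () _
idle⇒empty []       (txL ∷ _) _        (() , _) _ _  _
idle⇒empty (s1 ∷ _) (txL ∷ _) _        _       () _  _
idle⇒empty (sx ∷ _) (txL ∷ _) _        _       _  () _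
idle⇒empty _        (txR ∷ _) []       (_ , ()) _ _  _
idle⇒empty _        (txR ∷ _) (s1 ∷ _) _       _  _  ()
idle⇒empty _        (txR ∷ _) (sx ∷ _) _       _  () _

stuck⇒empty : ∀ u → Balanced u → ZeroLetter (nextMoveOf u) → u ≡ ∅
stuck⇒empty (u₁ , u₂ , u₃) bal (s₁ , s₂ , s₃) with n₁ , n₂ , n₃ ← nextMove-isNextMove (head u₁) (head u₂) (head u₃) =
  idle⇒empty u₁ u₂ u₃ bal (trans (sym n₁) s₁) (trans (sym n₂) s₂) (trans (sym n₃) s₃)

consumes₁ : ∀ u h₂ → ∃ λ v → u ≡ consumed (next₁ (head u) h₂) ++ v
consumes₁ []       _          = [] , refl
consumes₁ (s1 ∷ u) _          = u , refl
consumes₁ (sx ∷ u) nothing    = sx ∷ u , refl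
consumes₁ (sx ∷ u) (just t1)  = sx ∷ u , refl
consumes₁ (sx ∷ u) (just txL) = u , refl
consumes₁ (sx ∷ u) (just txR) = sx ∷ u , refl

consumes₂ : ∀ h₁ u h₃ → ∃ λ v → u ≡ consumed₂ (next₂ h₁ (head u) h₃) ++ v
consumes₂ _         []        _         = [] , refl
consumes₂ _         (t1 ∷ u)  _         = u , refl
consumes₂ nothing   (txL ∷ u) _         = txL ∷ u , refl
consumes₂ (just s1) (txL ∷ u) _         = txL ∷ u , refl
consumes₂ (just sx) (txL ∷ u) _         = u , refl
consumes₂ _         (txR ∷ u) nothing   = txR ∷ u , refl
consumes₂ _         (txR ∷ u) (just s1) = txR ∷ u , refl
consumes₂ _         (txR ∷ u) (just sx) = u , refl

consumes₃ : ∀ h₂ u → ∃ λ v → u ≡ consumed (next₃ h₂ (head u)) ++ v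
consumes₃ _          []       = [] , refl
consumes₃ _          (s1 ∷ u) = u , refl
consumes₃ nothing    (sx ∷ u) = sx ∷ u , refl
consumes₃ (just t1)  (sx ∷ u) = sx ∷ u , refl
consumes₃ (just txL) (sx ∷ u) = sx ∷ u , refl
consumes₃ (just txR) (sx ∷ u) = u , refl

nextMove-consumes : ∀ u → ∃ λ v → u ≡ transitions (nextMoveOf u) ++ₚ v
nextMove-consumes (u₁ , u₂ , u₃)
  with n₁ , n₂ , n₃ ← nextMove-isNextMove (head u₁) (head u₂) (head u₃)
     | v₁ , e₁ ← consumes₁ u₁ (head u₂) | v₂ , e₂ ← consumes₂ (head u₁) u₂ (head u₃) | v₃ , e₃ ← consumes₃ (head u₂) u₃
  rewrite n₁ | n₂ | n₃ = (v₁ , v₂ , v₃) , cong₂ _,_ e₁ (cong₂ _,_ e₂ e₃)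

size : Paths → ℕ
size (u₁ , u₂ , u₃) = length u₁ + length u₂ + length u₃

size-++ₚ : ∀ a v → a ≢ ∅ → size v < size (a ++ₚ v)
size-++ₚ ([] , [] , []) _ a≢∅ with () ← a≢∅ refl
size-++ₚ (_ ∷ a₁ , a₂ , a₃) (v₁ , v₂ , v₃) _ =
  +-mono-<-≤ (+-mono-<-≤ (s≤s (length-++-≤ʳ v₁ {a₁})) (length-++-≤ʳ v₂ {a₂})) (length-++-≤ʳ v₃ {a₃})
size-++ₚ ([] , _ ∷ a₂ , a₃) (v₁ , v₂ , v₃) _ =
  +-mono-<-≤ (+-mono-≤-< (length-++-≤ʳ v₁ {[]}) (s≤s (length-++-≤ʳ v₂ {a₂}))) (length-++-≤ʳ v₃ {a₃})
size-++ₚ ([] , [] , _ ∷ a₃) (v₁ , v₂ , v₃) _ =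
  +-mono-≤-< (+-mono-≤ (length-++-≤ʳ v₁ {[]}) (length-++-≤ʳ v₂ {[]})) (s≤s (length-++-≤ʳ v₃ {a₃}))

_≟∅ : ∀ u → Dec (u ≡ ∅)
([] , [] , [])    ≟∅ = yes refl
(_ ∷ _ , _ , _)   ≟∅ = no λ ()
([] , _ ∷ _ , _)  ≟∅ = no λ ()
([] , [] , _ ∷ _) ≟∅ = no λ ()

nextMove-progress : ∀ u → u ≢ ∅ → Balanced u → ∃ λ v →
  u ≡ transitions (nextMoveOf u) ++ₚ v × size v < size u × Balanced v × ¬ ZeroLetter (nextMoveOf u)
nextMove-progress u u≢∅ bal with v , u≡ ← nextMove-consumes u =
  v , u≡ ,
  subst (λ w → size v < size w) (sym u≡) (size-++ₚ (transitions t) v (moves ∘ transitions-≡∅ t)) ,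
  balanced-cancelˡ (transitions t) v (transitions-balanced t) (subst Balanced u≡ bal) ,
  moves
  where
  t = nextMoveOf u
  moves : ¬ ZeroLetter t
  moves stuck = u≢∅ (stuck⇒empty u bal stuck)

prepend-accepted : ∀ u ρ → u ≡ transitions (nextMoveOf u) ++ₚ projections ρ → ¬ ZeroLetter (nextMoveOf u) →
  AcceptedByW ρ → AcceptedByW (nextMoveOf u ∷ ρ)
prepend-accepted u []       _ moves _          = moves ∷ [] , [-]
prepend-accepted u (t' ∷ ρ) e moves (ms , lk) =
  moves ∷ ms ,
  subst (λ t'' → ¬ BadPair (nextMoveOf u) t'') (sym (nextMove-determined t' ρ lk)) (nextMoveOf-compatible u _ e) ∷ lk

accepted-exists : ∀ u → Acc _<_ (size u) → Balanced u → ∃ λ π → projections π ≡ u × AcceptedByW π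
accepted-exists u (acc rs) bal with u ≟∅
... | yes refl = [] , refl , [] , []
... | no u≢∅ with v , u≡ , v<u , bal-v , moves ← nextMove-progress u u≢∅ bal
             with ρ , refl , acc-ρ ← accepted-exists v (rs v<u) bal-v =
  nextMoveOf u ∷ ρ , trans (projections-∷ (nextMoveOf u) ρ) (sym u≡) , prepend-accepted u ρ u≡ moves acc-ρ

proposition2 : (u₁ : List S13) (u₂ : List S2) (u₃ : List S13) →
    ∃ (λ π → HasProjections π u₁ u₂ u₃) →
    ∃! _≡_ (λ π → HasProjections π u₁ u₂ u₃ × AcceptedByW π)
proposition2 _ _ _ (π , refl , refl , refl)
  with π* , e , acc* ← accepted-exists (projections π) (<-wellFounded _) (projections-balanced π) =
  π* , (paths-injective e , acc*) ,
  λ ((e₁ , e₂ , e₃) , acc') → accepted-unique π* _ (trans e (sym (cong₂ _,_ e₁ (cong₂ _,_ e₂ e₃)))) acc* acc'
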